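{- A collection $\mathcal C$ of languages over a countably infinite universe $U$ is generatable in the limit without samples if and only if there exists a countable sequence of collections $\mathcal C_0\subseteq\mathcal C_1\subseteq\cdots$ such that $\mathcal C=\bigcup_{i\in\mathbb N}\mathcal C_i$ and $\bigl|\bigcap_{L\in\mathcal C_i}L\bigr|=\infty$ for all $i\in\mathbb N$.
   Context: A language is an infinite subset of $U$; a collection is a (possibly uncountable) set of languages. A generator without samples is an injection $G:\mathbb N\to U$, with output $z_t=G(t)$ at time $t$. $G$ generates in the limit without samples for $\mathcal C$ if for every $K\in\mathcal C$ there exists $t^\star$ such that $z_t\in K$ for all $t\ge t^\star$; $\mathcal C$ is generatable in the limit without samples if such a $G$ exists. -}

module Defs where

open import Level using (Level; 0ℓ; suc)
open import Data.Nat using (ℕ; _≥_; _+_)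
open import Data.Product using (Σ; ∃; _×_; proj₁)
open import Data.List using (List)
open import Data.List.Membership.Propositional using (_∉_)
open import Relation.Unary using (Pred)
open import Relation.Binary.PropositionalEquality using (_≡_)
open import Function.Bundles using (_⇔_)
open import Function.Definitions using (Injective)

module _ {U : Set} where

  Infinite : {ℓ : Level} → Pred U ℓ → Set ℓ
  Infinite A = (xs : List U) → ∃ λ x → A x × x ∉ xs

  Language : Set₁
  Language = Σ (Pred U 0ℓ) Infinite

  Collection : Set₂
  Collection = Pred Language (suc 0ℓ)

  ⋂ : Collection → Pred U (suc 0ℓ)
  ⋂ C x = (L : Language) → C L → proj₁ L x

  GeneratesWithoutSamples : (ℕ → U) → Collection → Set₁
  GeneratesWithoutSamples G C =
    Injective _≡_ _≡_ G ×
    ((K : Language) → C K → ∃ λ t⋆ → (t : ℕ) → t ≥ t⋆ → proj₁ K (G t))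

  GeneratableWithoutSamples : Collection → Set₁
  GeneratableWithoutSamples C = ∃ λ (G : ℕ → U) → GeneratesWithoutSamples G C

  HasInfiniteIntersectionChain : Collection → Set₂
  HasInfiniteIntersectionChain C =
    ∃ λ (Cs : ℕ → Collection) →
      ((i : ℕ) (L : Language) → Cs i L → Cs (1 + i) L) ×
      ((L : Language) → C L ⇔ (∃ λ i → Cs i L)) ×
      ((i : ℕ) → Infinite (⋂ (Cs i)))

-- A generator G determines the chain Cᵢ = {L ∈ C : G t ∈ L for all t ≥ i}; its union is C,
-- and ⋂ Cᵢ contains the infinite tail {G t : t ≥ i} of the injective sequence G.
-- Conversely, since every ⋂ Cᵢ is infinite, one can choose at each time t an element of
-- ⋂ Cₜ different from all earlier outputs; a language of Cᵢ lies in every Cₜ with t ≥ i,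
-- so it contains all outputs from time i on.
module Submission where

open import Defs
open import Level using (Level)
open import Data.Nat using (ℕ; zero; suc; _+_; _≤_; _<_; _≥_; _≤′_; ≤′-refl; ≤′-step; z≤n; s≤s⁻¹)
open import Data.Nat.Properties
  using (≤-refl; ≤-trans; n≤1+n; <⇒≱; <⇒≢; m≤n⇒m<n∨m≡n; <-cmp; ≤⇒≤′)
open import Data.Product using (∃; _×_; _,_; proj₁; proj₂)
open import Data.Sum using (inj₁; inj₂)
open import Data.List using (List; []; _∷_; map)
open import Data.List.Extrema.Nat using (max; xs≤max)
open import Data.List.Relation.Unary.All using (lookup)
open import Data.List.Relation.Unary.Any using (here; there)
open import Data.List.Membership.Propositional using (_∈_; _∉_)
open import Data.List.Membership.Propositional.Properties using (∈-map⁺)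
open import Data.Empty using (⊥-elim)
open import Relation.Unary using (Pred; _⊆_)
open import Relation.Binary using (tri<; tri≈; tri>)
open import Relation.Binary.PropositionalEquality using (_≡_; _≢_; refl; sym; trans; subst)
open import Function.Bundles using (_⇔_; _↔_; Inverse; Injection; mk⇔; Equivalence)
open import Function.Definitions using (Injective)
open import Function.Properties.Inverse using (↔⇒↣)
open import Function.Base using (_∘_; _∘′_)

private
  variable
    a ℓ : Level
    A : Set a

∉-beyond-max : (xs : List ℕ) {n : ℕ} → max 0 xs < n → n ∉ xs
∉-beyond-max xs max<n n∈xs = <⇒≱ max<n (lookup (xs≤max 0 xs) n∈xs)

injective⇒unbounded : {h : ℕ → ℕ} → Injective _≡_ _≡_ h →
  (M i : ℕ) → ∃ λ t → i ≤ t × M ≤ h t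
injective⇒unbounded h-inj zero i = i , ≤-refl , z≤n
injective⇒unbounded h-inj (suc M) i with injective⇒unbounded h-inj M i
... | t , i≤t , M≤ht with m≤n⇒m<n∨m≡n M≤ht
...   | inj₁ M<ht = t , i≤t , M<ht
-- h takes the value M only at t, so searching beyond t gives M < h t′.
...   | inj₂ M≡ht with injective⇒unbounded h-inj M (suc t)
...     | t′ , t<t′ , M≤ht′ with m≤n⇒m<n∨m≡n M≤ht′
...       | inj₁ M<ht′ = t′ , ≤-trans i≤t (≤-trans (n≤1+n t) t<t′) , M<ht′
...       | inj₂ M≡ht′ = ⊥-elim (<⇒≢ t<t′ (h-inj (trans (sym M≡ht) M≡ht′)))

injective-tail-escapes : {U : Set} → U ↔ ℕ → {G : ℕ → U} → Injective _≡_ _≡_ G →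
  (i : ℕ) (xs : List U) → ∃ λ t → i ≤ t × G t ∉ xs
injective-tail-escapes iso {G} G-inj i xs =
  let t , i≤t , max<toGt = injective⇒unbounded toG-injective (suc (max 0 (map to xs))) i
  in t , i≤t , λ Gt∈xs → ∉-beyond-max (map to xs) max<toGt (∈-map⁺ to Gt∈xs)
  where
  open Inverse iso
  toG-injective : Injective _≡_ _≡_ (to ∘ G)
  toG-injective = G-inj ∘ Injection.injective (↔⇒↣ iso)

increasing⇒monotone : {P : ℕ → Pred A ℓ} → (∀ i → P i ⊆ P (suc i)) →
  ∀ {i j} → i ≤ j → P i ⊆ P j
increasing⇒monotone {P = P} step = go ∘′ ≤⇒≤′
  where
  go : ∀ {i j} → i ≤′ j → P i ⊆ P j
  go ≤′-refl = λ Px → Px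
  go (≤′-step i≤′j) = step _ ∘′ go i≤′j

module _ {U : Set} (S : ℕ → Pred U ℓ) (S-infinite : ∀ t → Infinite (S t)) where

  private
    history : ℕ → List U
    history zero = []
    history (suc t) = proj₁ (S-infinite t (history t)) ∷ history t

    choice : ℕ → U
    choice t = proj₁ (S-infinite t (history t))

    choice-∈ : ∀ t → S t (choice t)
    choice-∈ t = proj₁ (proj₂ (S-infinite t (history t)))

    choice-fresh : ∀ t → choice t ∉ history t
    choice-fresh t = proj₂ (proj₂ (S-infinite t (history t)))

    choice-∈-history : ∀ {s t} → s < t → choice s ∈ history t
    choice-∈-history {s} {suc t} s<1+t with m≤n⇒m<n∨m≡n (s≤s⁻¹ s<1+t)
    ... | inj₁ s<t = there (choice-∈-history s<t)
    ... | inj₂ refl = here refl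

    choice-distinct : ∀ {s t} → s < t → choice s ≢ choice t
    choice-distinct {t = t} s<t eq = choice-fresh t (subst (_∈ history t) eq (choice-∈-history s<t))

    choice-injective : Injective _≡_ _≡_ choice
    choice-injective {s} {t} eq with <-cmp s t
    ... | tri< s<t _ _ = ⊥-elim (choice-distinct s<t eq)
    ... | tri≈ _ s≡t _ = s≡t
    ... | tri> _ _ t<s = ⊥-elim (choice-distinct t<s (sym eq))

  infinite-family⇒injective-section :
    ∃ λ (G : ℕ → U) → Injective _≡_ _≡_ G × (∀ t → S t (G t))
  infinite-family⇒injective-section = choice , choice-injective , choice-∈

generatable⇒chain : {U : Set} → U ↔ ℕ → (C : Collection {U}) →
  GeneratableWithoutSamples C → HasInfiniteIntersectionChain C
generatable⇒chain iso C (G , G-inj , G-generates) =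
  Cs , Cs-increasing , Cs-covers , Cs-infinite
  where
  Cs : ℕ → Collection
  Cs i L = C L × (∀ t → t ≥ i → proj₁ L (G t))

  Cs-increasing : (i : ℕ) (L : Language) → Cs i L → Cs (1 + i) L
  Cs-increasing i L (L∈C , L∋G) = L∈C , λ t 1+i≤t → L∋G t (≤-trans (n≤1+n i) 1+i≤t)

  Cs-covers : (L : Language) → C L ⇔ (∃ λ i → Cs i L)
  Cs-covers L = mk⇔
    (λ L∈C → let t⋆ , L∋G = G-generates L L∈C in t⋆ , L∈C , L∋G)
    (λ (_ , L∈C , _) → L∈C)

  Cs-infinite : (i : ℕ) → Infinite (⋂ (Cs i))
  Cs-infinite i xs =
    let t , i≤t , Gt∉xs = injective-tail-escapes iso G-inj i xs
    in G t , (λ L (_ , L∋G) → L∋G t i≤t) , Gt∉xs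

chain⇒generatable : {U : Set} (C : Collection {U}) →
  HasInfiniteIntersectionChain C → GeneratableWithoutSamples C
chain⇒generatable C (Cs , Cs-increasing , Cs-covers , Cs-infinite)
  with infinite-family⇒injective-section (λ t → ⋂ (Cs t)) Cs-infinite
... | G , G-inj , G-∈⋂ = G , G-inj , G-generates
  where
  G-generates : (K : Language) → C K → ∃ λ t⋆ → (t : ℕ) → t ≥ t⋆ → proj₁ K (G t)
  G-generates K K∈C =
    let i , K∈Cᵢ = Equivalence.to (Cs-covers K) K∈C
    in i , λ t i≤t → G-∈⋂ t K (increasing⇒monotone (λ j {L} → Cs-increasing j L) i≤t K∈Cᵢ)

theorem1p3 : {U : Set} → U ↔ ℕ → (C : Collection {U}) →
    GeneratableWithoutSamples C ⇔ HasInfiniteIntersectionChain C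
theorem1p3 iso C = mk⇔ (generatable⇒chain iso C) (chain⇒generatable C)
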